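{- Let $\Sigma$ be an alphabet with $\sigma=|\Sigma|$ and $w\in\Sigma^n$. At most $\binom{\sigma}{2}n$ fragments of $w$ (i.e., pairs of positions $(i,j)$ such that $w[i..j]$ has the property) are imbalanced parameterized squares.
   Context: For a word $u$, $\mathrm{Alph}(u)$ is the set of letters occurring in $u$. A parameterized square is a word $uv$ with $u,v$ nonempty, $|u|=|v|$, and a bijection $f:\mathrm{Alph}(u)\to\mathrm{Alph}(v)$ such that $v[t]=f(u[t])$ for all $t=1,\ldots,|u|$. It is imbalanced if $\mathrm{Alph}(u)\ne\mathrm{Alph}(v)$. $w[i..j]$ denotes the fragment $w[i]\cdots w[j]$. -}

module Defs where

open import Data.Nat using (ℕ; suc; _∸_)
open import Data.Fin using (Fin)
open import Data.List using (List; map; take; drop; length; _++_)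
open import Data.List.Membership.Propositional using (_∈_)
open import Data.Product using (Σ; ∃; ∃-syntax; _×_)
open import Relation.Binary.PropositionalEquality using (_≡_)
open import Relation.Nullary using (¬_)
open import Function.Bundles using (_⇔_)

-- Alphabet Σ is modelled as Fin σ (any alphabet with σ letters).
-- Words are lists of letters; positions are 0-based.

SameAlph : {σ : ℕ} → List (Fin σ) → List (Fin σ) → Set
SameAlph u v = ∀ a → (a ∈ u) ⇔ (a ∈ v)

BijOnAlph : {σ : ℕ} → (Fin σ → Fin σ) → List (Fin σ) → List (Fin σ) → Set
BijOnAlph f u v =
  (∀ a → a ∈ u → f a ∈ v) ×
  (∀ a b → a ∈ u → b ∈ u → f a ≡ f b → a ≡ b) ×
  (∀ b → b ∈ v → ∃[ a ] (a ∈ u × f a ≡ b))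

PSquareSplit : {σ : ℕ} → List (Fin σ) → List (Fin σ) → Set
PSquareSplit u v =
  (1 Data.Nat.≤ length u) × length u ≡ length v ×
  ∃[ f ] (BijOnAlph f u v × map f u ≡ v)

ImbalancedPSquare : {σ : ℕ} → List (Fin σ) → Set
ImbalancedPSquare x =
  ∃[ u ] ∃[ v ] (x ≡ u ++ v × PSquareSplit u v × ¬ SameAlph u v)

-- fragment w[i..j] (0-based, inclusive)
fragment : {σ : ℕ} → List (Fin σ) → ℕ → ℕ → List (Fin σ)
fragment w i j = take (suc j ∸ i) (drop i w)

-- Let uv be an imbalanced parameterized square with bijection f. Since f maps Alph(u)
-- injectively into Alph(v), the inclusion Alph(v) ⊆ Alph(u) would force equality, so some
-- letter b of v does not occur in u. If b first occurs in v at offset t and c = u[t], then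
-- f(c) = b, c first occurs in u at t, and c ≠ b. In uv the first occurrences of c and b are
-- thus |u| apart, so a fragment starting at i is determined by i and the unordered pair
-- {c, b}: its length is twice the distance between the first occurrences of c and b in w
-- from position i on. This injects the imbalanced squares into (σ choose 2) × n codes.

module Submission where

open import Defs
open import Data.Nat using (ℕ; _≤_; _<_; _*_)
open import Data.Nat.Combinatorics using (_C_)
open import Data.Fin using (Fin)
open import Data.List using (List; length)
open import Data.List.Relation.Unary.All using (All)
open import Data.List.Relation.Unary.Unique.Propositional using (Unique)
open import Data.Product using (_×_; _,_)

open import Data.Nat using (zero; suc; _+_; _∸_; _⊓_; ∣_-_∣; s≤s)
open import Data.Nat.Properties
open import Data.Nat.Combinatorics using (nC1≡n; nCk+nC[k+1]≡[n+1]C[k+1])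
open import Data.Nat.GeneralisedArithmetic using (fold)
open import Data.Fin using (toℕ; fromℕ<; combine; remQuot)
  renaming (zero to fzero; suc to fsuc; _<_ to _<ᶠ_)
import Data.Fin.Properties as Fin
open import Data.List using ([]; _∷_; _++_; map; take; drop; lookup)
open import Data.List.Properties using (length-take; length-++; length-drop; take++drop≡id)
open import Data.List.Membership.Propositional using (_∈_; _∉_; find; lose)
open import Data.List.Membership.Propositional.Properties using (∈-lookup)
import Data.List.Membership.DecPropositional as DecMembership
open import Data.List.Relation.Unary.All using ([]; _∷_)
import Data.List.Relation.Unary.All as All
open import Data.List.Relation.Unary.All.Properties using (¬Any⇒All¬)
open import Data.List.Relation.Unary.Any using (here; there; any?)
import Data.List.Relation.Unary.Any as Any
open import Data.List.Relation.Unary.AllPairs using (_∷_)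
open import Data.Product using (∃; ∃-syntax)
open import Data.Product.Properties using (,-injective)
open import Function using (_∘_)
open import Function.Bundles using (mk⇔)
open import Relation.Binary using (DecidableEquality; tri<; tri≈; tri>)
open import Relation.Binary.PropositionalEquality
open import Relation.Nullary using (¬_; yes; no; contradiction)
open import Relation.Nullary.Decidable using (¬?; decidable-stable)

private
  variable
    A B : Set

data FirstIndex {A : Set} (a : A) : List A → ℕ → Set where
  here  : ∀ {xs} → FirstIndex a (a ∷ xs) 0
  there : ∀ {x xs k} → a ≢ x → FirstIndex a xs k → FirstIndex a (x ∷ xs) (suc k)

module _ {a : A} where

  firstIndex-unique : ∀ {xs k l} → FirstIndex a xs k → FirstIndex a xs l → k ≡ l
  firstIndex-unique here          here          = refl
  firstIndex-unique here          (there a≢a _) = contradiction refl a≢a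
  firstIndex-unique (there a≢a _) here          = contradiction refl a≢a
  firstIndex-unique (there _ p)   (there _ q)   = cong suc (firstIndex-unique p q)

  firstIndex⇒∈ : ∀ {xs k} → FirstIndex a xs k → a ∈ xs
  firstIndex⇒∈ here        = here refl
  firstIndex⇒∈ (there _ p) = there (firstIndex⇒∈ p)

  firstIndex-++⁺ˡ : ∀ {xs k} ys → FirstIndex a xs k → FirstIndex a (xs ++ ys) k
  firstIndex-++⁺ˡ ys here          = here
  firstIndex-++⁺ˡ ys (there a≢x p) = there a≢x (firstIndex-++⁺ˡ ys p)

  firstIndex-++⁺ʳ : ∀ {xs ys k} → All (a ≢_) xs → FirstIndex a ys k →
                    FirstIndex a (xs ++ ys) (length xs + k)
  firstIndex-++⁺ʳ []           p = p
  firstIndex-++⁺ʳ (a≢x ∷ a∉xs) p = there a≢x (firstIndex-++⁺ʳ a∉xs p)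

  firstIndex-take⁻ : ∀ n {xs k} → FirstIndex a (take n xs) k → FirstIndex a xs k
  firstIndex-take⁻ n {xs} p = subst (λ ys → FirstIndex a ys _) (take++drop≡id n xs)
                                    (firstIndex-++⁺ˡ (drop n xs) p)

firstIndex-map⁻ : ∀ (f : A → B) {b xs k} → FirstIndex b (map f xs) k →
                  ∃[ a ] f a ≡ b × FirstIndex a xs k
firstIndex-map⁻ f {xs = x ∷ xs} here = x , refl , here
firstIndex-map⁻ f {xs = x ∷ xs} (there b≢fx p) with a , refl , q ← firstIndex-map⁻ f p =
  a , refl , there (b≢fx ∘ cong f) q

module _ (_≟_ : DecidableEquality A) where

  ∈⇒firstIndex : ∀ {a : A} {xs} → a ∈ xs → ∃ (FirstIndex a xs)
  ∈⇒firstIndex {a} {x ∷ xs} a∈ with a ≟ x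
  ... | yes refl = 0 , here
  ... | no a≢x with k , p ← ∈⇒firstIndex (Any.tail a≢x a∈) = suc k , there a≢x p

module _ {n : ℕ} {U V : Fin n → Set} (f : Fin n → Fin n)
         (f-maps : ∀ {a} → U a → V (f a))
         (f-injective : ∀ {a a′} → U a → U a′ → f a ≡ f a′ → a ≡ a′)
         (V⊆U : ∀ {b} → V b → U b) where

  -- The orbit of a point outside V stays in U and, a not being in the image, never repeats.
  injectionIntoSubset⇒superset : ∀ {a} → U a → ¬ ¬ V a
  injectionIntoSubset⇒superset {a} a∈U a∉V
    with i , j , i<j , orbitᵢ≡orbitⱼ ← Fin.pigeonhole (n<1+n n) (λ k → fold a f (toℕ k))
    = orbit-injective (toℕ i) (toℕ j) i<j orbitᵢ≡orbitⱼ
    where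
    orbit⊆U : ∀ k → U (fold a f k)
    orbit⊆U zero    = a∈U
    orbit⊆U (suc k) = V⊆U (f-maps (orbit⊆U k))

    orbit-injective : ∀ p q → p < q → fold a f p ≢ fold a f q
    orbit-injective zero    (suc q) _         a≡fq = a∉V (subst V (sym a≡fq) (f-maps (orbit⊆U q)))
    orbit-injective (suc p) (suc q) (s≤s p<q) fp≡fq =
      orbit-injective p q p<q (f-injective (orbit⊆U p) (orbit⊆U q) fp≡fq)

module _ {σ : ℕ} where

  open DecMembership (Fin._≟_ {σ}) using (_∈?_)

  ¬SameAlph⇒∃newLetter : ∀ {f u v} → BijOnAlph f u v → ¬ SameAlph u v → ∃[ b ] b ∈ v × b ∉ u
  ¬SameAlph⇒∃newLetter {f} {u} {v} (f-maps , f-injective , _) ¬same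
    with any? (λ b → ¬? (b ∈? u)) v
  ... | yes new = find new
  ... | no ¬new = contradiction (λ a → mk⇔ (u⊆v a) (v⊆u a)) ¬same
    where
    v⊆u : ∀ b → b ∈ v → b ∈ u
    v⊆u b b∈v = decidable-stable (b ∈? u) (¬new ∘ lose b∈v)

    u⊆v : ∀ a → a ∈ u → a ∈ v
    u⊆v a a∈u = decidable-stable (a ∈? v)
      (injectionIntoSubset⇒superset f (f-maps _) (λ {a} {a′} → f-injective a a′) (v⊆u _) a∈u)

record PairAnchor {σ : ℕ} (y : List (Fin σ)) (k : ℕ) : Set where
  field
    lo hi      : Fin σ
    lo<hi      : lo <ᶠ hi
    {posˡ posʰ} : ℕ
    firstˡ     : FirstIndex lo y posˡ
    firstʰ     : FirstIndex hi y posʰ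
    halfLength : k ≡ ∣ posˡ - posʰ ∣ + ∣ posˡ - posʰ ∣

pairAnchor : ∀ {σ} {y : List (Fin σ)} {c b p q} → c ≢ b →
             FirstIndex c y p → FirstIndex b y q → PairAnchor y (∣ p - q ∣ + ∣ p - q ∣)
pairAnchor {c = c} {b} {p} {q} c≢b firstᶜ firstᵇ with Fin.<-cmp c b
... | tri< c<b _ _ = record { lo<hi = c<b ; firstˡ = firstᶜ ; firstʰ = firstᵇ ; halfLength = refl }
... | tri≈ _ c≡b _ = contradiction c≡b c≢b
... | tri> _ _ b<c = record { lo<hi = b<c ; firstˡ = firstᵇ ; firstʰ = firstᶜ
                            ; halfLength = cong (λ d → d + d) (∣-∣-comm p q) }

pairAnchor-length-unique : ∀ {σ} {y : List (Fin σ)} {k k′} (P : PairAnchor y k) (Q : PairAnchor y k′) →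
                           PairAnchor.lo P ≡ PairAnchor.lo Q → PairAnchor.hi P ≡ PairAnchor.hi Q → k ≡ k′
pairAnchor-length-unique {y = y} {k} {k′} P Q lo≡ hi≡ = begin
  k                                         ≡⟨ P.halfLength ⟩
  ∣ P.posˡ - P.posʰ ∣ + ∣ P.posˡ - P.posʰ ∣ ≡⟨ cong (λ d → d + d) (cong₂ ∣_-_∣ posˡ≡ posʰ≡) ⟩
  ∣ Q.posˡ - Q.posʰ ∣ + ∣ Q.posˡ - Q.posʰ ∣ ≡⟨ sym Q.halfLength ⟩
  k′                                        ∎
  where
  module P = PairAnchor P
  module Q = PairAnchor Q
  open ≡-Reasoning
  posˡ≡ : P.posˡ ≡ Q.posˡ
  posˡ≡ = firstIndex-unique (subst (λ c → FirstIndex c y _) lo≡ P.firstˡ) Q.firstˡ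
  posʰ≡ : P.posʰ ≡ Q.posʰ
  posʰ≡ = firstIndex-unique (subst (λ c → FirstIndex c y _) hi≡ P.firstʰ) Q.firstʰ

∣m-n+m∣≡n : ∀ m n → ∣ m - n + m ∣ ≡ n
∣m-n+m∣≡n m n = trans (cong ∣ m -_∣ (+-comm n m)) (∣m-m+n∣≡n m n)

imbalancedPrefix⇒pairAnchor : ∀ {σ} {y : List (Fin σ)} {k} → k ≤ length y →
                               ImbalancedPSquare (take k y) → PairAnchor y k
imbalancedPrefix⇒pairAnchor {y = y} {k} k≤∣y∣
  (u , v , y≡uv , (_ , ∣u∣≡∣v∣ , f , f-bij , fu≡v) , ¬same)
  with b , b∈v , b∉u ← ¬SameAlph⇒∃newLetter f-bij ¬same
  with t , bᵥ ← ∈⇒firstIndex Fin._≟_ b∈v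
  with c , refl , cᵤ ← firstIndex-map⁻ f (subst (λ z → FirstIndex b z t) (sym fu≡v) bᵥ)
  = subst (PairAnchor y) (sym k≡L+L)
      (subst (λ d → PairAnchor y (d + d)) (∣m-n+m∣≡n t L) (pairAnchor c≢fc cʸ fcʸ))
  where
  L = length u
  cʸ : FirstIndex c y t
  cʸ = firstIndex-take⁻ k (subst (λ z → FirstIndex c z t) (sym y≡uv) (firstIndex-++⁺ˡ v cᵤ))
  fcʸ : FirstIndex (f c) y (L + t)
  fcʸ = firstIndex-take⁻ k (subst (λ z → FirstIndex (f c) z (L + t)) (sym y≡uv)
                                   (firstIndex-++⁺ʳ (¬Any⇒All¬ u b∉u) bᵥ))
  c≢fc : c ≢ f c
  c≢fc c≡fc = b∉u (subst (_∈ u) c≡fc (firstIndex⇒∈ cᵤ))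
  k≡L+L : k ≡ L + L
  k≡L+L = begin
    k                  ≡⟨ sym (m≤n⇒m⊓n≡m k≤∣y∣) ⟩
    k ⊓ length y       ≡⟨ sym (length-take k y) ⟩
    length (take k y)  ≡⟨ cong length y≡uv ⟩
    length (u ++ v)    ≡⟨ length-++ u ⟩
    L + length v       ≡⟨ cong (L +_) (sym ∣u∣≡∣v∣) ⟩
    L + L              ∎
    where open ≡-Reasoning

pairIndex : ∀ {s} {x y : Fin s} → x <ᶠ y → ℕ
pairIndex {suc s} {fzero}  {fsuc y} _         = toℕ y
pairIndex {suc s} {fsuc x} {fsuc y} (s≤s x<y) = s + pairIndex x<y

[1+n]C2≡n+nC2 : ∀ n → suc n C 2 ≡ n + n C 2
[1+n]C2≡n+nC2 n = trans (sym (nCk+nC[k+1]≡[n+1]C[k+1] n 1)) (cong (_+ n C 2) (nC1≡n n))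

pairIndex< : ∀ {s} {x y : Fin s} (x<y : x <ᶠ y) → pairIndex x<y < s C 2
pairIndex< {suc s} {fzero}  {fsuc y} _ =
  subst (toℕ y <_) (sym ([1+n]C2≡n+nC2 s)) (<-≤-trans (Fin.toℕ<n y) (m≤m+n s _))
pairIndex< {suc s} {fsuc x} {fsuc y} (s≤s x<y) =
  subst (s + pairIndex x<y <_) (sym ([1+n]C2≡n+nC2 s)) (+-monoʳ-< s (pairIndex< x<y))

pairIndex-injective : ∀ {s} {x y x′ y′ : Fin s} (x<y : x <ᶠ y) (x′<y′ : x′ <ᶠ y′) →
                      pairIndex x<y ≡ pairIndex x′<y′ → x ≡ x′ × y ≡ y′
pairIndex-injective {suc s} {fzero} {fsuc y} {fzero} {fsuc y′} _ _ e =
  refl , cong fsuc (Fin.toℕ-injective e)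
pairIndex-injective {suc s} {fzero} {fsuc y} {fsuc x′} {fsuc y′} _ (s≤s _) e =
  contradiction e (<⇒≢ (<-≤-trans (Fin.toℕ<n y) (m≤m+n s _)))
pairIndex-injective {suc s} {fsuc x} {fsuc y} {fzero} {fsuc y′} (s≤s _) _ e =
  contradiction (sym e) (<⇒≢ (<-≤-trans (Fin.toℕ<n y′) (m≤m+n s _)))
pairIndex-injective {suc s} {fsuc x} {fsuc y} {fsuc x′} {fsuc y′} (s≤s x<y) (s≤s x′<y′) e
  with refl , refl ← pairIndex-injective x<y x′<y′ (+-cancelˡ-≡ s _ _ e) = refl , refl

combine-injective : ∀ {m n} {i i′ : Fin m} {j j′ : Fin n} → combine i j ≡ combine i′ j′ → i ≡ i′ × j ≡ j′
combine-injective {n = n} {i} {i′} {j} {j′} e = ,-injective (begin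
  (i , j)                   ≡⟨ sym (Fin.remQuot-combine i j) ⟩
  remQuot n (combine i j)   ≡⟨ cong (remQuot n) e ⟩
  remQuot n (combine i′ j′) ≡⟨ Fin.remQuot-combine i′ j′ ⟩
  (i′ , j′)                 ∎)
  where open ≡-Reasoning

lookup-injective : ∀ {xs : List A} → Unique xs → ∀ i j → lookup xs i ≡ lookup xs j → i ≡ j
lookup-injective (_ ∷ _)         fzero    fzero    _ = refl
lookup-injective (x∉xs ∷ _)      fzero    (fsuc j) e = contradiction e (All.lookup x∉xs (∈-lookup j))
lookup-injective (x∉xs ∷ _)      (fsuc i) fzero    e = contradiction (sym e) (All.lookup x∉xs (∈-lookup i))
lookup-injective (_ ∷ xs-unique) (fsuc i) (fsuc j) e = cong fsuc (lookup-injective xs-unique i j e)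

injective⇒length≤ : ∀ {P : A → Set} {N} (code : ∀ {x} → P x → Fin N) →
                    (∀ {x y} (px : P x) (py : P y) → code px ≡ code py → x ≡ y) →
                    ∀ {xs} → Unique xs → All P xs → length xs ≤ N
injective⇒length≤ code code-injective {xs} xs-unique all-P =
  Fin.injective⇒≤ λ {i} {j} e → lookup-injective xs-unique i j (code-injective (P-at i) (P-at j) e)
  where
  P-at = λ i → All.lookup all-P (∈-lookup i)

module _ {σ : ℕ} (w : List (Fin σ)) where

  ImbalancedFragment : ℕ → ℕ → Set
  ImbalancedFragment i j = i ≤ j × j < length w × ImbalancedPSquare (fragment w i j)

  fragmentAnchor : ∀ {i j} → ImbalancedFragment i j → PairAnchor (drop i w) (suc j ∸ i)
  fragmentAnchor {i} (_ , j<n , imb) = imbalancedPrefix⇒pairAnchor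
    (subst (suc _ ∸ i ≤_) (sym (length-drop i w)) (∸-monoˡ-≤ i j<n)) imb

  pairCode : ∀ {i j} → ImbalancedFragment i j → Fin (σ C 2)
  pairCode q = fromℕ< (pairIndex< (PairAnchor.lo<hi (fragmentAnchor q)))

  startCode : ∀ {i j} → ImbalancedFragment i j → Fin (length w)
  startCode (i≤j , j<n , _) = fromℕ< (≤-<-trans i≤j j<n)

  fragmentCode : ∀ {i j} → ImbalancedFragment i j → Fin ((σ C 2) * length w)
  fragmentCode q = combine (pairCode q) (startCode q)

  pairCode-injective : ∀ {i j i′ j′} (q : ImbalancedFragment i j) (q′ : ImbalancedFragment i′ j′) →
                       pairCode q ≡ pairCode q′ →
                       PairAnchor.lo (fragmentAnchor q) ≡ PairAnchor.lo (fragmentAnchor q′) ×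
                       PairAnchor.hi (fragmentAnchor q) ≡ PairAnchor.hi (fragmentAnchor q′)
  pairCode-injective q q′ e = pairIndex-injective lo<hi lo<hi′
    (Fin.fromℕ<-injective _ _ (pairIndex< lo<hi) (pairIndex< lo<hi′) e)
    where
    lo<hi  = PairAnchor.lo<hi (fragmentAnchor q)
    lo<hi′ = PairAnchor.lo<hi (fragmentAnchor q′)

  fragmentCode-injective : ∀ {i j i′ j′} (q : ImbalancedFragment i j) (q′ : ImbalancedFragment i′ j′) →
                           fragmentCode q ≡ fragmentCode q′ → (i , j) ≡ (i′ , j′)
  fragmentCode-injective {i} {i′ = i′} q@(i≤j , j<n , _) q′@(i′≤j′ , j′<n , _) e
    with pair≡ , start≡ ← combine-injective e
    with refl ← Fin.fromℕ<-injective i i′ (≤-<-trans i≤j j<n) (≤-<-trans i′≤j′ j′<n) start≡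
    with lo≡ , hi≡ ← pairCode-injective q q′ pair≡
    = cong (i ,_) (suc-injective (∸-cancelʳ-≡ (m≤n⇒m≤1+n i≤j) (m≤n⇒m≤1+n i′≤j′)
        (pairAnchor-length-unique (fragmentAnchor q) (fragmentAnchor q′) lo≡ hi≡)))

lemma17 : (σ : ℕ) (w : List (Fin σ)) (ps : List (ℕ × ℕ)) →
    Unique ps →
    All (λ { (i , j) → i ≤ j × j < length w × ImbalancedPSquare (fragment w i j) }) ps →
    length ps ≤ (σ C 2) * length w
lemma17 σ w ps ps-unique ps-imbalanced =
  injective⇒length≤ (λ { {i , j} → fragmentCode w {i} {j} })
                    (λ { {i , j} {i′ , j′} → fragmentCode-injective w })
                    ps-unique ps-imbalanced
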